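{- Let $n\ge3$ and consider the one-part composition $(n)$. Then (1a) $\mathrm{Int}_{n,a}((n))=\mathrm{Int}_{a,n}((n))=2^{a-2}$ for $2\le a\le n-1$; (1b) $\mathrm{Int}_{a,b}((n))=0$ if ($a\ne n$ and $b\ne n$), or $a=1$, or $b=1$; (2a) $\mathrm{Ini}_{1,n}((n))=1$ and $\mathrm{Ini}_{1,b}((n))=0$ for $b<n$; (2b) $\mathrm{Ini}_{a,b}((n))=\mathrm{Int}_{a,b}((n))$ if $a\ne1$.
   Context: Permutations $\sigma\in\mathcal S_n$ are words $\sigma_1\cdots\sigma_n$; $i$ is a peak if $\sigma_{i-1}<\sigma_i>\sigma_{i+1}$. If the peak set of $\sigma$ is $\{i_1<\dots<i_k\}$, its peak-composition is $(c_1,\dots,c_{k+1})$, $c_j=i_j-i_{j-1}$, $i_0=0$, $i_{k+1}=n$; $\mathcal P(\mathbf c)$ is the set of $\sigma\in\mathcal S_n$ with peak-composition $\mathbf c$ (so $\mathcal P((n))$ is the set of permutations with no peak). For a composition $\mathbf c$ of $n$ and positive integers $a,b$: $Ini_{a,b}(\mathbf c)=\{\sigma\in\mathcal P(\mathbf c):\sigma_1=a,\ \sigma_{n-1}<\sigma_n=b\}$, $Int_{a,b}(\mathbf c)=\{\sigma\in\mathcal P(\mathbf c):a=\sigma_1>\sigma_2,\ \sigma_{n-1}<\sigma_n=b\}$; $\mathrm{Ini}_{a,b},\mathrm{Int}_{a,b}$ are their cardinalities. -}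

module Defs where

open import Data.Nat using (ℕ; zero; suc; _+_; _∸_; _<_; _<ᵇ_)
open import Data.Bool using (Bool; true; false; if_then_else_; _∧_)
open import Data.List using (List; []; _∷_; length; applyUpTo)
open import Data.Maybe using (Maybe; just; nothing)
open import Data.Product using (Σ; _×_; _,_)
open import Data.List.Membership.Propositional using (_∈_)
open import Data.List.Relation.Unary.Unique.Propositional using (Unique)
open import Data.List.Relation.Binary.Permutation.Propositional using (_↭_)
open import Function.Bundles using (_⇔_)
open import Relation.Binary.PropositionalEquality using (_≡_)

-- A permutation σ ∈ S_n is the word σ₁⋯σₙ, a list that is a rearrangement of [1,…,n].
IsPerm : ℕ → List ℕ → Set
IsPerm n σ = σ ↭ applyUpTo suc n

-- peak positions (1-indexed); the first argument is the position of the second letter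
peaksFrom : ℕ → List ℕ → List ℕ
peaksFrom i (x ∷ y ∷ z ∷ r) =
  if (x <ᵇ y) ∧ (z <ᵇ y) then i ∷ peaksFrom (suc i) (y ∷ z ∷ r) else peaksFrom (suc i) (y ∷ z ∷ r)
peaksFrom i _ = []

peakSet : List ℕ → List ℕ
peakSet σ = peaksFrom 2 σ

-- differences c_j = i_j - i_{j-1} with i_0 = prev and i_{k+1} = n
diffs : ℕ → ℕ → List ℕ → List ℕ
diffs n prev [] = (n ∸ prev) ∷ []
diffs n prev (i ∷ is) = (i ∸ prev) ∷ diffs n i is

peakComp : ℕ → List ℕ → List ℕ
peakComp n σ = diffs n 0 (peakSet σ)

InP : ℕ → List ℕ → List ℕ → Set
InP n c σ = IsPerm n σ × peakComp n σ ≡ c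

firstTwo : List ℕ → Maybe (ℕ × ℕ)
firstTwo (x ∷ y ∷ _) = just (x , y)
firstTwo _ = nothing

head′ : List ℕ → Maybe ℕ
head′ (x ∷ _) = just x
head′ [] = nothing

lastTwo : List ℕ → Maybe (ℕ × ℕ)
lastTwo (x ∷ y ∷ []) = just (x , y)
lastTwo (x ∷ y ∷ z ∷ r) = lastTwo (y ∷ z ∷ r)
lastTwo _ = nothing

Ini : ℕ → List ℕ → ℕ → ℕ → List ℕ → Set
Ini n c a b σ = InP n c σ × head′ σ ≡ just a
  × Σ ℕ (λ x → lastTwo σ ≡ just (x , b) × x < b)

Int : ℕ → List ℕ → ℕ → ℕ → List ℕ → Set
Int n c a b σ = InP n c σ × Σ ℕ (λ y → firstTwo σ ≡ just (a , y) × y < a)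
  × Σ ℕ (λ x → lastTwo σ ≡ just (x , b) × x < b)

HasCard : (List ℕ → Set) → ℕ → Set
HasCard P k = Σ (List (List ℕ)) λ L → Unique L × (∀ σ → (σ ∈ L) ⇔ P σ) × length L ≡ k

module Submission where

-- The whole argument rests on one structural fact (PP-split): in a peakless permutation
-- of [1,…,k+1] the letter k+1 stands at an end, and deleting it leaves a peakless
-- permutation of [1,…,k]; conversely k+1 may be put at either end.  Hence there are 2^k
-- peakless permutations of [1,…,k+1] (peakless-count), and those ending with an ascent to
-- b ≤ k are obtained from the ones of [1,…,b] by putting b+1, …, k in front
-- (rising-count, 2^(b-2) of them); this gives (1a) for Int_{n,a}, and reversal, which
-- preserves peaklessness and swaps the two ends, gives Int_{a,n}.  Further, a peakless
-- permutation of distinct letters that ascends once ascends to the end, so it is the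
-- identity; thus it starts with 1 only if it is the identity (2a), and otherwise starts
-- with a descent, which makes Ini and Int coincide (2b).  Part (1b) says that a word
-- cannot descend to 0 or ascend from 0, and that n must sit at one end.

open import Defs
open import Data.Nat using (ℕ; zero; suc; _+_; _∸_; _^_; _≤_; _<_; _<ᵇ_; z≤n; s≤s; _≟_; _<?_)
open import Data.Nat.Properties
  using (<ᵇ⇒<; <⇒<ᵇ; <-asym; <-irrefl; ≮⇒≥; ≤∧≢⇒<; <⇒≤; ≤-trans; n<1+n; n≤1+n; m≤n⇒m≤1+n;
         m≤n⇒m<n∨m≡n; 1+n≰n; ≤⇒≯; +-identityʳ; <⇒≢; suc-injective; ≤-totalOrder; <-cmp)
open import Data.Bool using (true; false; _∧_; T; if_then_else_)
open import Data.Unit using (⊤; tt)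
open import Data.Empty using (⊥; ⊥-elim)
open import Data.List using (List; []; _∷_; _∷ʳ_; _++_; length; map; filter; reverse; applyUpTo)
open import Data.List.Properties
  using (length-map; length-++; ∷-injectiveˡ; ∷-injectiveʳ; ∷ʳ-injectiveˡ; ∷ʳ-injectiveʳ;
         applyUpTo-∷ʳ; ++-assoc; ʳ++-defn; unfold-reverse; reverse-++; reverse-involutive; reverse-injective)
open import Data.List.Relation.Unary.All using (All; []; _∷_)
import Data.List.Relation.Unary.All as All
open import Data.List.Relation.Unary.Any using (here; there)
open import Data.List.Relation.Unary.AllPairs using ([]; _∷_)
open import Data.List.Relation.Unary.Linked using ([]; [-]; _∷_)
open import Data.List.Relation.Unary.Linked.Properties using (applyUpTo⁺₂)
open import Data.List.Relation.Unary.Sorted.TotalOrder ≤-totalOrder using (Sorted)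
open import Data.List.Relation.Unary.Sorted.TotalOrder.Properties using (↗↭↗⇒≋)
open import Data.List.Relation.Binary.Pointwise using (Pointwise-≡⇒≡)
open import Data.List.Membership.Propositional using (_∈_)
open import Data.List.Membership.Propositional.Properties
  using (∈-map⁺; ∈-map⁻; ∈-++⁺ˡ; ∈-++⁺ʳ; ∈-++⁻; ∈-filter⁺; ∈-filter⁻; ∈-applyUpTo⁺; ∈-applyUpTo⁻)
open import Data.List.Relation.Unary.Unique.Propositional using (Unique)
import Data.List.Relation.Unary.Unique.Propositional.Properties as Unique
open import Data.List.Relation.Binary.Permutation.Propositional
  using (prep; ↭-refl; ↭-sym; ↭-trans; ↭-reflexive; ↭⇒↭ₛ)
open import Data.List.Relation.Binary.Permutation.Propositional.Properties
  using (∈-resp-↭; All-resp-↭; drop-∷; ∷↭∷ʳ; ↭-reverse; ↭-singleton-inv; ¬x∷xs↭[])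
import Data.List.Relation.Binary.Permutation.Setoid.Properties as PermSetoid
open import Data.Maybe using (just)
open import Data.Product using (Σ; _×_; _,_; proj₁; proj₂)
open import Data.Sum using (_⊎_; inj₁; inj₂; [_,_])
open import Function using (_∘_)
open import Function.Bundles using (_⇔_; mk⇔; Equivalence)
import Function.Properties.Equivalence as ⇔
open import Relation.Nullary using (¬_; Dec; yes; no)
open import Relation.Binary.Definitions using (tri<; tri≈; tri>)
open import Relation.Nullary.Decidable using (_×-dec_)
open import Relation.Binary.PropositionalEquality
  using (_≡_; _≢_; refl; sym; trans; cong; cong₂; subst; setoid; module ≡-Reasoning)

private
  variable
    k n a b x y z : ℕ
    σ τ r : List ℕ
    P Q : List ℕ → Set

HasCard-resp : (∀ σ → P σ ⇔ Q σ) → HasCard P k → HasCard Q k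
HasCard-resp P⇔Q (L , L! , L⇔P , |L|) = L , L! , (λ σ → ⇔.trans (L⇔P σ) (P⇔Q σ)) , |L|

HasCard-empty : (∀ {σ} → ¬ P σ) → HasCard P 0
HasCard-empty ¬P = [] , [] , (λ σ → mk⇔ (λ ()) (⊥-elim ∘ ¬P)) , refl

HasCard-single : P τ → (∀ {σ} → P σ → σ ≡ τ) → HasCard P 1
HasCard-single {P = P} {τ = τ} Pτ only = τ ∷ [] , [] ∷ [] , (λ σ → mk⇔ to (here ∘ only)) , refl
  where
  to : ∀ {σ} → σ ∈ τ ∷ [] → P σ
  to (here refl) = Pτ

Image : (List ℕ → List ℕ) → (List ℕ → Set) → List ℕ → Set
Image f P σ = Σ (List ℕ) λ τ → P τ × σ ≡ f τ

HasCard-image : ∀ {f} → (∀ {σ τ} → f σ ≡ f τ → σ ≡ τ) → HasCard P k → HasCard (Image f P) k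
HasCard-image {P = P} {f = f} inj (L , L! , L⇔P , |L|) =
  map f L , Unique.map⁺ inj L! , (λ σ → mk⇔ to from) , trans (length-map f L) |L|
  where
  to : ∀ {σ} → σ ∈ map f L → Image f P σ
  to m with τ , τ∈L , refl ← ∈-map⁻ f m = τ , Equivalence.to (L⇔P τ) τ∈L , refl
  from : ∀ {σ} → Image f P σ → σ ∈ map f L
  from (τ , Pτ , refl) = ∈-map⁺ f (Equivalence.from (L⇔P τ) Pτ)

HasCard-union : ∀ {m} → HasCard P m → HasCard Q n → (∀ {σ} → P σ → Q σ → ⊥) →
  HasCard (λ σ → P σ ⊎ Q σ) (m + n)
HasCard-union {P = P} {Q = Q} (L , L! , L⇔P , |L|) (M , M! , M⇔Q , |M|) disjoint =
  L ++ M , Unique.++⁺ L! M! (λ (σ∈L , σ∈M) → disjoint (inL σ∈L) (inM σ∈M)) ,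
  (λ σ → mk⇔ to from) , trans (length-++ L) (cong₂ _+_ |L| |M|)
  where
  inL : ∀ {σ} → σ ∈ L → P σ
  inL {σ} = Equivalence.to (L⇔P σ)
  inM : ∀ {σ} → σ ∈ M → Q σ
  inM {σ} = Equivalence.to (M⇔Q σ)
  to : ∀ {σ} → σ ∈ L ++ M → P σ ⊎ Q σ
  to m with ∈-++⁻ L m
  ... | inj₁ σ∈L = inj₁ (inL σ∈L)
  ... | inj₂ σ∈M = inj₂ (inM σ∈M)
  from : ∀ {σ} → P σ ⊎ Q σ → σ ∈ L ++ M
  from {σ} (inj₁ Pσ) = ∈-++⁺ˡ (Equivalence.from (L⇔P σ) Pσ)
  from {σ} (inj₂ Qσ) = ∈-++⁺ʳ L (Equivalence.from (M⇔Q σ) Qσ)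

HasCard-filter : HasCard P k → (Q? : ∀ σ → Dec (Q σ)) → Σ ℕ (HasCard (λ σ → P σ × Q σ))
HasCard-filter {P = P} {Q = Q} (L , L! , L⇔P , _) Q? =
  length (filter Q? L) , filter Q? L , Unique.filter⁺ Q? L! , (λ σ → mk⇔ to from) , refl
  where
  to : ∀ {σ} → σ ∈ filter Q? L → P σ × Q σ
  to {σ} m with σ∈L , Qσ ← ∈-filter⁻ Q? {xs = L} m = Equivalence.to (L⇔P σ) σ∈L , Qσ
  from : ∀ {σ} → P σ × Q σ → σ ∈ filter Q? L
  from {σ} (Pσ , Qσ) = ∈-filter⁺ Q? (Equivalence.from (L⇔P σ) Pσ) Qσ

NoPeak : ℕ → ℕ → ℕ → Set
NoPeak x y z = ¬ (x < y × z < y)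

noPeak-fromᵇ : ((x <ᵇ y) ∧ (z <ᵇ y)) ≡ false → NoPeak x y z
noPeak-fromᵇ noPeak (x<y , z<y) = both-true (<⇒<ᵇ x<y) (<⇒<ᵇ z<y) noPeak
  where
  both-true : ∀ {p q} → T p → T q → (p ∧ q) ≡ false → ⊥
  both-true {true} {true} _ _ ()

noPeak-toᵇ : NoPeak x y z → ((x <ᵇ y) ∧ (z <ᵇ y)) ≡ false
noPeak-toᵇ {x} {y} {z} noPeak with x <ᵇ y in x<ᵇy | z <ᵇ y in z<ᵇy
... | false | _     = refl
... | true  | false = refl
... | true  | true  = ⊥-elim (noPeak (<ᵇ⇒< x y (subst T (sym x<ᵇy) tt) , <ᵇ⇒< z y (subst T (sym z<ᵇy) tt)))

noPeak-sym : NoPeak x y z → NoPeak z y x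
noPeak-sym noPeak (z<y , x<y) = noPeak (x<y , z<y)

noPeak-descent : y < x → NoPeak x y z
noPeak-descent y<x (x<y , _) = <-asym x<y y<x

noPeak-ascent : NoPeak x y z → x < y → y ≤ z
noPeak-ascent noPeak x<y = ≮⇒≥ λ z<y → noPeak (x<y , z<y)

Peakless : List ℕ → Set
Peakless (x ∷ y ∷ z ∷ r) = NoPeak x y z × Peakless (y ∷ z ∷ r)
Peakless _ = ⊤

if-[]⁻ : ∀ c {i : ℕ} {A B : List ℕ} → (if c then i ∷ A else B) ≡ [] → c ≡ false × B ≡ []
if-[]⁻ false B≡[] = refl , B≡[]
if-[]⁻ true ()

if-[]⁺ : ∀ c {i : ℕ} {A B : List ℕ} → c ≡ false → B ≡ [] → (if c then i ∷ A else B) ≡ []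
if-[]⁺ false _ B≡[] = B≡[]

peaksFrom-Peakless : ∀ i σ → peaksFrom i σ ≡ [] → Peakless σ
peaksFrom-Peakless i (x ∷ y ∷ z ∷ r) none =
  noPeak-fromᵇ (proj₁ (if-[]⁻ _ none)) , peaksFrom-Peakless (suc i) (y ∷ z ∷ r) (proj₂ (if-[]⁻ _ none))
peaksFrom-Peakless i [] none = tt
peaksFrom-Peakless i (x ∷ []) none = tt
peaksFrom-Peakless i (x ∷ y ∷ []) none = tt

Peakless-peaksFrom : ∀ i σ → Peakless σ → peaksFrom i σ ≡ []
Peakless-peaksFrom i (x ∷ y ∷ z ∷ r) (noPeak , rest) =
  if-[]⁺ ((x <ᵇ y) ∧ (z <ᵇ y)) (noPeak-toᵇ noPeak) (Peakless-peaksFrom (suc i) (y ∷ z ∷ r) rest)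
Peakless-peaksFrom i [] _ = refl
Peakless-peaksFrom i (x ∷ []) _ = refl
Peakless-peaksFrom i (x ∷ y ∷ []) _ = refl

Peakless-tail : ∀ x σ → Peakless (x ∷ σ) → Peakless σ
Peakless-tail x (y ∷ z ∷ r) (_ , rest) = rest
Peakless-tail x [] _ = tt
Peakless-tail x (y ∷ []) _ = tt

Peakless-window : ∀ ρ {r} → Peakless (ρ ++ x ∷ y ∷ z ∷ r) → NoPeak x y z
Peakless-window [] (noPeak , _) = noPeak
Peakless-window (p ∷ ρ) peakless = Peakless-window ρ (Peakless-tail p (ρ ++ _) peakless)

windows-Peakless : ∀ σ → (∀ ρ {x y z} r → σ ≡ ρ ++ x ∷ y ∷ z ∷ r → NoPeak x y z) → Peakless σ
windows-Peakless (x ∷ y ∷ z ∷ r) windows =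
  windows [] r refl , windows-Peakless (y ∷ z ∷ r) λ ρ r′ eq → windows (x ∷ ρ) r′ (cong (x ∷_) eq)
windows-Peakless [] _ = tt
windows-Peakless (x ∷ []) _ = tt
windows-Peakless (x ∷ y ∷ []) _ = tt

-- Reversing a word turns its windows around, and NoPeak is symmetric.
Peakless-reverse : Peakless σ → Peakless (reverse σ)
Peakless-reverse {σ} peakless = windows-Peakless (reverse σ) λ ρ r eq →
  noPeak-sym (Peakless-window (reverse r) (subst Peakless (reversed-window ρ r eq) peakless))
  where
  open ≡-Reasoning
  reversed-window : ∀ ρ {x y z} r → reverse σ ≡ ρ ++ x ∷ y ∷ z ∷ r →
    σ ≡ reverse r ++ z ∷ y ∷ x ∷ reverse ρ
  reversed-window ρ {x} {y} {z} r eq = begin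
    σ                                         ≡⟨ sym (reverse-involutive σ) ⟩
    reverse (reverse σ)                       ≡⟨ cong reverse eq ⟩
    reverse (ρ ++ x ∷ y ∷ z ∷ r)              ≡⟨ reverse-++ ρ (x ∷ y ∷ z ∷ r) ⟩
    reverse (x ∷ y ∷ z ∷ r) ++ reverse ρ      ≡⟨ cong (_++ reverse ρ) (ʳ++-defn r) ⟩
    (reverse r ++ z ∷ y ∷ x ∷ []) ++ reverse ρ ≡⟨ ++-assoc (reverse r) (z ∷ y ∷ x ∷ []) (reverse ρ) ⟩
    reverse r ++ z ∷ y ∷ x ∷ reverse ρ        ∎

Peakless-cons : Peakless σ → All (_< x) σ → Peakless (x ∷ σ)
Peakless-cons {y ∷ z ∷ r} peakless (y<x ∷ _) = noPeak-descent y<x , peakless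
Peakless-cons {[]} _ _ = tt
Peakless-cons {y ∷ []} _ _ = tt

Peakless-snoc : Peakless σ → All (_< x) σ → Peakless (σ ∷ʳ x)
Peakless-snoc {σ} {x} peakless below = subst Peakless reverse-cons-reverse
  (Peakless-reverse (Peakless-cons (Peakless-reverse peakless) (All-resp-↭ (↭-sym (↭-reverse σ)) below)))
  where
  reverse-cons-reverse : reverse (x ∷ reverse σ) ≡ σ ∷ʳ x
  reverse-cons-reverse = trans (unfold-reverse x (reverse σ)) (cong (_∷ʳ x) (reverse-involutive σ))

Peakless-init : Peakless (σ ∷ʳ x) → Peakless σ
Peakless-init {σ} {x} peakless = subst Peakless (reverse-involutive σ)
  (Peakless-reverse (Peakless-tail x (reverse σ) (subst Peakless (reverse-++ σ (x ∷ [])) (Peakless-reverse peakless))))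

-- The largest letter of a peakless word of distinct letters stands at one of its ends:
-- anywhere in the interior it would be a peak.
max-at-end : ∀ {m} σ → Peakless σ → Unique σ → m ∈ σ → All (_≤ m) σ →
  Σ (List ℕ) (λ τ → σ ≡ m ∷ τ) ⊎ Σ (List ℕ) (λ τ → σ ≡ τ ∷ʳ m)
max-at-end (x ∷ τ) _ _ (here refl) _ = inj₁ (τ , refl)
max-at-end (x ∷ y ∷ []) _ _ (there (here refl)) _ = inj₂ (x ∷ [] , refl)
max-at-end (x ∷ y ∷ z ∷ r) (noPeak , peakless) ((x≢y ∷ _) ∷ unique@((y≢z ∷ _) ∷ _)) (there m∈) (x≤m ∷ below)
  with max-at-end (y ∷ z ∷ r) peakless unique m∈ below
... | inj₂ (τ , eq) = inj₂ (x ∷ τ , cong (x ∷_) eq)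
... | inj₁ (τ , refl) = ⊥-elim (noPeak (≤∧≢⇒< x≤m x≢y , ≤∧≢⇒< (All.head (All.tail below)) (y≢z ∘ sym)))

upto : ℕ → List ℕ
upto k = applyUpTo suc k

upto-snoc : ∀ k → upto (suc k) ≡ upto k ∷ʳ suc k
upto-snoc k = sym (applyUpTo-∷ʳ suc k)

perm-bound : IsPerm k σ → x ∈ σ → 1 ≤ x × x ≤ k
perm-bound perm x∈σ with i , i<k , refl ← ∈-applyUpTo⁻ suc (∈-resp-↭ perm x∈σ) = s≤s z≤n , i<k

perm-below : IsPerm k σ → All (_< suc k) σ
perm-below perm = All.tabulate λ x∈σ → s≤s (proj₂ (perm-bound perm x∈σ))

perm-unique : IsPerm k σ → Unique σ
perm-unique {k} perm = PermSetoid.Unique-resp-↭ (setoid ℕ) (↭⇒↭ₛ (↭-sym perm)) upto-unique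
  where
  upto-unique : Unique (upto k)
  upto-unique = Unique.applyUpTo⁺₁ suc k λ i<j _ eq → <⇒≢ i<j (suc-injective eq)

perm-cons : IsPerm k τ → IsPerm (suc k) (suc k ∷ τ)
perm-cons {k} perm = ↭-trans (prep (suc k) perm) (↭-trans (∷↭∷ʳ (suc k) (upto k)) (↭-reflexive (sym (upto-snoc k))))

perm-snoc : IsPerm k τ → IsPerm (suc k) (τ ∷ʳ suc k)
perm-snoc {τ = τ} perm = ↭-trans (↭-sym (∷↭∷ʳ _ τ)) (perm-cons perm)

perm-cons⁻ : IsPerm (suc k) (suc k ∷ τ) → IsPerm k τ
perm-cons⁻ perm = drop-∷ (↭-trans perm (↭-sym (perm-cons ↭-refl)))

perm-snoc⁻ : IsPerm (suc k) (τ ∷ʳ suc k) → IsPerm k τ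
perm-snoc⁻ {τ = τ} perm = perm-cons⁻ (↭-trans (∷↭∷ʳ _ τ) perm)

PeaklessPerm : ℕ → List ℕ → Set
PeaklessPerm k σ = IsPerm k σ × Peakless σ

InP⇔PeaklessPerm : InP k (k ∷ []) σ ⇔ PeaklessPerm k σ
InP⇔PeaklessPerm {k} {σ} = mk⇔ (λ (perm , comp) → perm , peaksFrom-Peakless 2 σ (no-peaks (peakSet σ) comp))
                               (λ (perm , peakless) → perm , cong (diffs k 0) (Peakless-peaksFrom 2 σ peakless))
  where
  no-peaks : ∀ ps → diffs k 0 ps ≡ k ∷ [] → ps ≡ []
  no-peaks [] _ = refl
  no-peaks (_ ∷ []) ()
  no-peaks (_ ∷ _ ∷ _) ()

PP-cons : PeaklessPerm k τ → PeaklessPerm (suc k) (suc k ∷ τ)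
PP-cons (perm , peakless) = perm-cons perm , Peakless-cons peakless (perm-below perm)

PP-snoc : PeaklessPerm k τ → PeaklessPerm (suc k) (τ ∷ʳ suc k)
PP-snoc (perm , peakless) = perm-snoc perm , Peakless-snoc peakless (perm-below perm)

PP-reverse : PeaklessPerm k σ → PeaklessPerm k (reverse σ)
PP-reverse {σ = σ} (perm , peakless) = ↭-trans (↭-reverse σ) perm , Peakless-reverse peakless

PP-upto : ∀ k → PeaklessPerm k (upto k)
PP-upto zero = ↭-refl , tt
PP-upto (suc k) = subst (PeaklessPerm (suc k)) (sym (upto-snoc k)) (PP-snoc (PP-upto k))

PP-split : PeaklessPerm (suc k) σ →
  Image (suc k ∷_) (PeaklessPerm k) σ ⊎ Image (_∷ʳ suc k) (PeaklessPerm k) σ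
PP-split {k} {σ} (perm , peakless)
  with max-at-end σ peakless (perm-unique perm) (∈-resp-↭ (↭-sym perm) (∈-applyUpTo⁺ suc (n<1+n k)))
                  (All.tabulate (proj₂ ∘ perm-bound perm))
... | inj₁ (τ , refl) = inj₁ (τ , (perm-cons⁻ perm , Peakless-tail (suc k) τ peakless) , refl)
... | inj₂ (τ , refl) = inj₂ (τ , (perm-snoc⁻ perm , Peakless-init peakless) , refl)

peakless-count : ∀ k → HasCard (PeaklessPerm (suc k)) (2 ^ k)
peakless-count zero = HasCard-single (PP-upto 1) (λ (perm , _) → ↭-singleton-inv perm)
peakless-count (suc k) = subst (HasCard (PeaklessPerm N)) (cong (2 ^ k +_) (sym (+-identityʳ (2 ^ k))))
  (HasCard-resp (λ σ → mk⇔ grow PP-split)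
    (HasCard-union (HasCard-image ∷-injectiveʳ (peakless-count k))
                   (HasCard-image (∷ʳ-injectiveˡ _ _) (peakless-count k)) front≢back))
  where
  N : ℕ
  N = suc (suc k)
  grow : Image (N ∷_) (PeaklessPerm (suc k)) σ ⊎ Image (_∷ʳ N) (PeaklessPerm (suc k)) σ → PeaklessPerm N σ
  grow (inj₁ (τ , pp , refl)) = PP-cons pp
  grow (inj₂ (τ , pp , refl)) = PP-snoc pp
  -- The first letter of τ ∷ʳ N lies in τ, hence is smaller than N.
  front≢back : Image (N ∷_) (PeaklessPerm (suc k)) σ → Image (_∷ʳ N) (PeaklessPerm (suc k)) σ → ⊥
  front≢back (_ , _ , refl) ([] , (perm , _) , _) = ¬x∷xs↭[] (↭-sym perm)
  front≢back (_ , _ , refl) (t ∷ w , (perm , _) , eq) =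
    <-irrefl refl (subst (_≤ suc k) (sym (∷-injectiveˡ eq)) (proj₂ (perm-bound perm (here refl))))

FallsFrom : ℕ → List ℕ → Set
FallsFrom a σ = Σ ℕ λ y → firstTwo σ ≡ just (a , y) × y < a

RisesTo : ℕ → List ℕ → Set
RisesTo b σ = Σ ℕ λ x → lastTwo σ ≡ just (x , b) × x < b

fallsFrom-view : FallsFrom a σ → Σ ℕ λ y → Σ (List ℕ) λ r → σ ≡ a ∷ y ∷ r × y < a
fallsFrom-view {σ = _ ∷ y ∷ r} (_ , refl , y<a) = y , r , refl , y<a

lastTwo-view : lastTwo σ ≡ just (x , b) → Σ (List ℕ) λ ρ → σ ≡ ρ ++ x ∷ b ∷ []
lastTwo-view {σ = _ ∷ _ ∷ []} refl = [] , refl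
lastTwo-view {σ = p ∷ y ∷ z ∷ r} eq with ρ , eq′ ← lastTwo-view {σ = y ∷ z ∷ r} eq = p ∷ ρ , cong (p ∷_) eq′

lastTwo-cons : ∀ {v} z σ → lastTwo σ ≡ just v → lastTwo (z ∷ σ) ≡ just v
lastTwo-cons z (_ ∷ _ ∷ []) eq = eq
lastTwo-cons z (_ ∷ _ ∷ _ ∷ _) eq = eq

lastTwo-++ : ∀ ρ → lastTwo (ρ ++ x ∷ y ∷ []) ≡ just (x , y)
lastTwo-++ [] = refl
lastTwo-++ (p ∷ ρ) = lastTwo-cons p (ρ ++ _) (lastTwo-++ ρ)

risesTo-cons : RisesTo b σ → RisesTo b (z ∷ σ)
risesTo-cons {σ = σ} {z = z} (x , eq , x<b) = x , lastTwo-cons z σ eq , x<b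

risesTo-uncons : RisesTo b (z ∷ τ) → RisesTo b τ ⊎ z < b
risesTo-uncons {τ = _ ∷ []} (_ , refl , z<b) = inj₂ z<b
risesTo-uncons {τ = _ ∷ _ ∷ _} rises = inj₁ rises

risesTo-mem : RisesTo b (z ∷ τ) → b ∈ τ
risesTo-mem {τ = _ ∷ []} (_ , refl , _) = here refl
risesTo-mem {τ = t ∷ _ ∷ _} rises = there (risesTo-mem {z = t} rises)

risesTo-snoc : ∀ t w → All (_< b) (t ∷ w) → RisesTo b ((t ∷ w) ∷ʳ b)
risesTo-snoc t [] (t<b ∷ []) = t , refl , t<b
risesTo-snoc t (u ∷ w) (_ ∷ below) = risesTo-cons {σ = (u ∷ w) ∷ʳ _} (risesTo-snoc u w below)

risesTo-last : RisesTo b (τ ∷ʳ y) → b ≡ y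
risesTo-last {τ = τ} {y = y} (x , eq , _) with ρ , eq′ ← lastTwo-view {σ = τ ∷ʳ y} eq =
  sym (∷ʳ-injectiveʳ τ (ρ ∷ʳ x) (trans eq′ (sym (++-assoc ρ (x ∷ []) (_ ∷ [])))))

risesTo-unique : ∀ {c} → RisesTo b σ → RisesTo c σ → b ≡ c
risesTo-unique (_ , eq , _) (_ , eq′ , _) with trans (sym eq) eq′
... | refl = refl

fallsFrom-reverse : FallsFrom a σ → RisesTo a (reverse σ)
fallsFrom-reverse falls with y , r , refl , y<a ← fallsFrom-view falls =
  y , trans (cong lastTwo (ʳ++-defn r)) (lastTwo-++ (reverse r)) , y<a

risesTo-reverse : RisesTo b σ → FallsFrom b (reverse σ)
risesTo-reverse {σ = σ} (x , eq , x<b) with ρ , refl ← lastTwo-view {σ = σ} eq =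
  x , cong firstTwo (reverse-++ ρ (x ∷ _ ∷ [])) , x<b

fallsFrom? : ∀ a σ → Dec (FallsFrom a σ)
fallsFrom? a (x ∷ y ∷ r) with x ≟ a | y <? a
... | yes refl | yes y<a = yes (y , refl , y<a)
... | yes refl | no y≮a  = no λ { (_ , refl , y<a) → y≮a y<a }
... | no x≢a   | _       = no λ { (_ , refl , _) → x≢a refl }
fallsFrom? a [] = no λ { (_ , () , _) }
fallsFrom? a (_ ∷ []) = no λ { (_ , () , _) }

risesTo? : ∀ b σ → Dec (RisesTo b σ)
risesTo? b (x ∷ y ∷ []) with y ≟ b | x <? b
... | yes refl | yes x<b = yes (x , refl , x<b)
... | yes refl | no x≮b  = no λ { (_ , refl , x<b) → x≮b x<b }
... | no y≢b   | _       = no λ { (_ , refl , _) → y≢b refl }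
risesTo? b (_ ∷ y ∷ z ∷ r) = risesTo? b (y ∷ z ∷ r)
risesTo? b [] = no λ { (_ , () , _) }
risesTo? b (_ ∷ []) = no λ { (_ , () , _) }

ascent-sorted : ∀ x y r → Peakless (x ∷ y ∷ r) → Unique (y ∷ r) → x < y → Sorted (x ∷ y ∷ r)
ascent-sorted x y [] _ _ x<y = <⇒≤ x<y ∷ [-]
ascent-sorted x y (z ∷ r) (noPeak , peakless) ((y≢z ∷ _) ∷ unique) x<y =
  <⇒≤ x<y ∷ ascent-sorted y z r peakless unique (≤∧≢⇒< (noPeak-ascent noPeak x<y) y≢z)

sorted-perm : IsPerm k σ → Sorted σ → σ ≡ upto k
sorted-perm {k} perm sorted =
  Pointwise-≡⇒≡ (↗↭↗⇒≋ ≤-totalOrder sorted (applyUpTo⁺₂ suc k λ i → n≤1+n (suc i)) (↭⇒↭ₛ perm))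

ascent-start : PeaklessPerm k (x ∷ y ∷ r) → x < y → x ∷ y ∷ r ≡ upto k
ascent-start (perm , peakless) x<y with _ ∷ unique ← perm-unique perm =
  sorted-perm perm (ascent-sorted _ _ _ peakless unique x<y)

one-start : PeaklessPerm k (1 ∷ y ∷ r) → 1 ∷ y ∷ r ≡ upto k
one-start pp@(perm , _) with (1≢y ∷ _) ∷ _ ← perm-unique perm =
  ascent-start pp (≤∧≢⇒< (proj₁ (perm-bound perm (there (here refl)))) 1≢y)

descent-start : PeaklessPerm k (a ∷ y ∷ r) → a ≢ 1 → y < a
descent-start {k} {a} {y} pp@(perm , _) a≢1 with <-cmp y a
... | tri< y<a _ _ = y<a
... | tri≈ _ y≡a _ with (a≢y ∷ _) ∷ _ ← perm-unique perm = ⊥-elim (a≢y (sym y≡a))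
... | tri> _ _ a<y = ⊥-elim (a≢1 (first-of-upto (ascent-start pp a<y)))
  where
  first-of-upto : ∀ {k σ} → a ∷ σ ≡ upto k → a ≡ 1
  first-of-upto {suc k} eq = ∷-injectiveˡ eq

Int⇔ : Int k (k ∷ []) a b σ ⇔ (PeaklessPerm k σ × (FallsFrom a σ × RisesTo b σ))
Int⇔ = mk⇔ (λ (inp , ends) → to inp , ends) (λ (pp , ends) → from pp , ends)
  where open Equivalence InP⇔PeaklessPerm

Int-reverse : Int k (k ∷ []) a b σ → Int k (k ∷ []) b a (reverse σ)
Int-reverse {σ = σ} int with pp , falls , rises ← Equivalence.to Int⇔ int =
  Equivalence.from Int⇔ (PP-reverse pp , risesTo-reverse {σ = σ} rises , fallsFrom-reverse {σ = σ} falls)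

RisingPerm : ℕ → ℕ → List ℕ → Set
RisingPerm k b σ = PeaklessPerm k σ × RisesTo b σ

rising-drop : b ≤ k → RisingPerm (suc k) b σ ⇔ Image (suc k ∷_) (RisingPerm k b) σ
rising-drop {b} {k} b≤k = mk⇔ to from
  where
  from : Image (suc k ∷_) (RisingPerm k b) σ → RisingPerm (suc k) b σ
  from (τ , (pp , rises) , refl) = PP-cons pp , risesTo-cons {σ = τ} rises
  to : RisingPerm (suc k) b σ → Image (suc k ∷_) (RisingPerm k b) σ
  to (pp , rises) with PP-split pp
  ... | inj₂ (τ , _ , refl) = ⊥-elim (<-irrefl (risesTo-last {τ = τ} rises) (s≤s b≤k))
  ... | inj₁ (τ , ppτ , refl) with risesTo-uncons {τ = τ} rises
  ...   | inj₁ risesτ = τ , (ppτ , risesτ) , refl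
  ...   | inj₂ k<b = ⊥-elim (1+n≰n (≤-trans (n≤1+n (suc k)) (≤-trans k<b b≤k)))

rising-top : RisingPerm (suc (suc k)) (suc (suc k)) σ ⇔ Image (_∷ʳ suc (suc k)) (PeaklessPerm (suc k)) σ
rising-top {k} = mk⇔ to from
  where
  N : ℕ
  N = suc (suc k)
  to : RisingPerm N N σ → Image (_∷ʳ N) (PeaklessPerm (suc k)) σ
  to (pp , rises) with PP-split pp
  ... | inj₂ image = image
  ... | inj₁ (τ , (perm , _) , refl) = ⊥-elim (1+n≰n (proj₂ (perm-bound perm (risesTo-mem rises))))
  from : Image (_∷ʳ N) (PeaklessPerm (suc k)) σ → RisingPerm N N σ
  from ([] , (perm , _) , _) = ⊥-elim (¬x∷xs↭[] (↭-sym perm))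
  from (t ∷ w , pp@(perm , _) , refl) = PP-snoc pp , risesTo-snoc t w (perm-below perm)

rising-count : ∀ k b → 2 ≤ b → b ≤ k → HasCard (RisingPerm k b) (2 ^ (b ∸ 2))
rising-count (suc k) b@(suc (suc i)) 2≤b@(s≤s (s≤s z≤n)) b≤1+k with m≤n⇒m<n∨m≡n b≤1+k
... | inj₁ (s≤s b≤k) =
  HasCard-resp (λ _ → ⇔.sym (rising-drop b≤k)) (HasCard-image ∷-injectiveʳ (rising-count k b 2≤b b≤k))
... | inj₂ refl =
  HasCard-resp (λ _ → ⇔.sym rising-top) (HasCard-image (∷ʳ-injectiveˡ _ _) (peakless-count i))

Int-top-first : b ≤ k → Int (suc k) (suc k ∷ []) (suc k) b σ ⇔ RisingPerm (suc k) b σ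
Int-top-first {b} {k} b≤k = mk⇔ (λ int → let pp , _ , rises = Equivalence.to Int⇔ int in pp , rises) from
  where
  from : RisingPerm (suc k) b σ → Int (suc k) (suc k ∷ []) (suc k) b σ
  from rising@(pp , rises) with Equivalence.to (rising-drop b≤k) rising
  ... | t ∷ _ , ((perm , _) , _) , refl = Equivalence.from Int⇔ (pp , (t , refl , All.head (perm-below perm)) , rises)
  ... | [] , (_ , _ , () , _) , refl

Int-top-last : Int k (k ∷ []) a k σ ⇔ Image reverse (Int k (k ∷ []) k a) σ
Int-top-last {σ = σ} = mk⇔ (λ int → reverse σ , Int-reverse int , sym (reverse-involutive σ)) from
  where
  from : Image reverse (Int _ _ _ _) σ → Int _ _ _ _ σ
  from (_ , int , refl) = Int-reverse int

no-fall-from-one : IsPerm k σ → ¬ FallsFrom 1 σ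
no-fall-from-one perm falls with y , r , refl , y<1 ← fallsFrom-view falls =
  ≤⇒≯ (proj₁ (perm-bound perm (there (here refl)))) y<1

no-rise-to-one : IsPerm k σ → ¬ RisesTo 1 σ
no-rise-to-one {σ = σ} perm (x , eq , x<1) with ρ , refl ← lastTwo-view {σ = σ} eq =
  ≤⇒≯ (proj₁ (perm-bound perm (∈-++⁺ʳ ρ (here refl)))) x<1

top-at-end : PeaklessPerm (suc k) σ → FallsFrom a σ → RisesTo b σ → a ≡ suc k ⊎ b ≡ suc k
top-at-end pp falls rises with PP-split pp
... | inj₁ (τ , _ , refl) with _ , _ , eq , _ ← fallsFrom-view falls = inj₁ (sym (∷-injectiveˡ eq))
... | inj₂ (τ , _ , refl) = inj₂ (risesTo-last {τ = τ} rises)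

Int-empty : (a ≢ suc k × b ≢ suc k) ⊎ (a ≡ 1 ⊎ b ≡ 1) → ¬ Int (suc k) (suc k ∷ []) a b σ
Int-empty (inj₂ (inj₁ refl)) ((perm , _) , falls , _) = no-fall-from-one perm falls
Int-empty (inj₂ (inj₂ refl)) ((perm , _) , _ , rises) = no-rise-to-one perm rises
Int-empty (inj₁ (a≢ , b≢)) int with pp , falls , rises ← Equivalence.to Int⇔ int =
  [ a≢ , b≢ ] (top-at-end pp falls rises)

identity-rises : RisesTo (suc (suc k)) (upto (suc (suc k)))
identity-rises {k} = subst (RisesTo (suc (suc k))) (sym (upto-snoc (suc k)))
  (risesTo-snoc 1 _ (perm-below (proj₁ (PP-upto (suc k)))))

identity-Ini : Ini (suc (suc k)) (suc (suc k) ∷ []) 1 (suc (suc k)) (upto (suc (suc k)))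
identity-Ini {k} = Equivalence.from InP⇔PeaklessPerm (PP-upto (suc (suc k))) , refl , identity-rises

Ini-one : Ini (suc (suc k)) (suc (suc k) ∷ []) 1 b σ → σ ≡ upto (suc (suc k)) × b ≡ suc (suc k)
Ini-one {k} {σ = 1 ∷ y ∷ r} (inp , refl , rises) with refl ← one-start (Equivalence.to InP⇔PeaklessPerm inp) =
  refl , risesTo-unique {σ = upto (suc (suc k))} rises identity-rises
Ini-one {σ = []} (_ , () , _)
Ini-one {σ = _ ∷ []} (_ , _ , _ , () , _)

Ini⇔Int : a ≢ 1 → Ini k (k ∷ []) a b σ ⇔ Int k (k ∷ []) a b σ
Ini⇔Int {a} {k} {b} a≢1 = mk⇔ to from
  where
  to : Ini k (k ∷ []) a b σ → Int k (k ∷ []) a b σ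
  to {y ∷ z ∷ r} (inp , refl , rises) =
    inp , (z , refl , descent-start (Equivalence.to InP⇔PeaklessPerm inp) a≢1) , rises
  to {[]} (_ , () , _)
  to {_ ∷ []} (_ , _ , _ , () , _)
  from : Int k (k ∷ []) a b σ → Ini k (k ∷ []) a b σ
  from (inp , falls , rises) with _ , _ , refl , _ ← fallsFrom-view falls = inp , refl , rises

-- (2b) Int_{a,b}((k+1)) is a decidable subset of the finite set 𝒫((k+1)), hence finite.
Int-finite : Σ ℕ (HasCard (Int (suc k) (suc k ∷ []) a b))
Int-finite {k} {a} {b} with count , card ← HasCard-filter (peakless-count k) (λ σ → fallsFrom? a σ ×-dec risesTo? b σ) =
  count , HasCard-resp (λ _ → ⇔.sym Int⇔) card

lemma3p2 : (n : ℕ) → 3 ≤ n →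
    -- (1a)
    ((a : ℕ) → 2 ≤ a → a ≤ n ∸ 1 →
      HasCard (Int n (n ∷ []) n a) (2 ^ (a ∸ 2)) × HasCard (Int n (n ∷ []) a n) (2 ^ (a ∸ 2)))
    -- (1b)
    × ((a b : ℕ) → 1 ≤ a → 1 ≤ b → ((a ≢ n × b ≢ n) ⊎ (a ≡ 1 ⊎ b ≡ 1)) →
      HasCard (Int n (n ∷ []) a b) 0)
    -- (2a)
    × (HasCard (Ini n (n ∷ []) 1 n) 1
      × ((b : ℕ) → 1 ≤ b → b < n → HasCard (Ini n (n ∷ []) 1 b) 0))
    -- (2b)
    × ((a b : ℕ) → 1 ≤ a → 1 ≤ b → a ≢ 1 →
      Σ ℕ (λ k → HasCard (Ini n (n ∷ []) a b) k × HasCard (Int n (n ∷ []) a b) k))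
lemma3p2 n@(suc k@(suc (suc _))) (s≤s (s≤s (s≤s z≤n))) = part1a , part1b , (part2a , part2a′) , part2b
  where
  part1a : (a : ℕ) → 2 ≤ a → a ≤ k →
    HasCard (Int n (n ∷ []) n a) (2 ^ (a ∸ 2)) × HasCard (Int n (n ∷ []) a n) (2 ^ (a ∸ 2))
  part1a a 2≤a a≤k = descending , HasCard-resp (λ _ → ⇔.sym Int-top-last) (HasCard-image reverse-injective descending)
    where
    descending : HasCard (Int n (n ∷ []) n a) (2 ^ (a ∸ 2))
    descending = HasCard-resp (λ _ → ⇔.sym (Int-top-first a≤k)) (rising-count n a 2≤a (m≤n⇒m≤1+n a≤k))
  part1b : (a b : ℕ) → 1 ≤ a → 1 ≤ b → ((a ≢ n × b ≢ n) ⊎ (a ≡ 1 ⊎ b ≡ 1)) → HasCard (Int n (n ∷ []) a b) 0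
  part1b _ _ _ _ excluded = HasCard-empty (Int-empty excluded)
  part2a : HasCard (Ini n (n ∷ []) 1 n) 1
  part2a = HasCard-single identity-Ini (proj₁ ∘ Ini-one)
  part2a′ : (b : ℕ) → 1 ≤ b → b < n → HasCard (Ini n (n ∷ []) 1 b) 0
  part2a′ _ _ b<n = HasCard-empty λ ini → <-irrefl (proj₂ (Ini-one ini)) b<n
  part2b : (a b : ℕ) → 1 ≤ a → 1 ≤ b → a ≢ 1 →
    Σ ℕ (λ k → HasCard (Ini n (n ∷ []) a b) k × HasCard (Int n (n ∷ []) a b) k)
  part2b _ _ _ _ a≢1 with count , card ← Int-finite = count , HasCard-resp (λ _ → ⇔.sym (Ini⇔Int a≢1)) card , card
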